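{- Let $\tau$, $\mathcal M_1$, $\mathcal M_2$ be as described in the context, let $i,\ell\in\{1,2\}$, and let $\mathcal N_\ell=\beta(\mathcal M_\ell)$. If $D_1\in P_i^{\mathcal N_\ell}$ and $D_2=j_\ell(a)$ for some $a\in P_i^{\mathcal M_\ell}$, then $F^{\mathcal N_\ell}(D_1,D_2)=F^{\mathcal N_\ell}(D_2,D_1)$.
   Context: Ultrafilter quantifier: for a set $M$, an ultrafilter $D$ on $M$ and a formula $\varphi(x,\ldots)$, $(\forall^D x)\,\varphi(x,\ldots)$ means $\{a\in M:\varphi(a,\ldots)\}\in D$. For a model $\mathcal M$ with universe $M$ in vocabulary $\tau$, the ultrafilter extension $\beta(\mathcal M)$ is the $\tau$-model with universe $\beta(M)$ = set of all ultrafilters on $M$; for an $n$-ary predicate symbol $P$, $P^{\beta(\mathcal M)}=\{(D_1,\ldots,D_n):(\forall^{D_1}x_1)\ldots(\forall^{D_n}x_n)\,P^{\mathcal M}(x_1,\ldots,x_n)\}$; for an $n$-ary function symbol $F$, $F^{\beta(\mathcal M)}(D_1,\ldots,D_n)$ is the ultrafilter $D$ with $A\in D\iff(\forall^{D_1}x_1)\ldots(\forall^{D_n}x_n)\,F^{\mathcal M}(x_1,\ldots,x_n)\in A$ for all $A\subseteq M$. $j_M(a)=\{A\subseteq M:a\in A\}$ is the principal ultrafilter at $a$; write $j_\ell=j_{M_\ell}$ where $M_\ell$ is the universe of $\mathcal M_\ell$. $\tau$ consists of unary predicate symbols $P_1,P_2$, binary predicate symbols $R_1,R_2$, and a binary function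 symbol $F$. $\mathcal M_1$ is any $\tau$-model with: universe $M_1=\mathbb N\sqcup\mathcal P(\mathbb N)$; $P_1^{\mathcal M_1}=\mathbb N$; $P_2^{\mathcal M_1}=\mathcal P(\mathbb N)$; $R_1^{\mathcal M_1}=\{(n,a):n\in\mathbb N,\ a\in\mathcal P(\mathbb N),\ n\in a\}$; $R_2^{\mathcal M_1}$ restricted to $\mathbb N\times\mathbb N$ is the usual order, restricted to $\mathcal P(\mathbb N)\times\mathcal P(\mathbb N)$ is a linear order with no endpoints, arbitrary on mixed pairs; $F^{\mathcal M_1}$ maps $\mathbb N\times\mathbb N$ into $\mathbb N$ and $\mathcal P(\mathbb N)\times\mathcal P(\mathbb N)$ into $\mathcal P(\mathbb N)$, with $F^{\mathcal M_1}(a_1,b_1)=F^{\mathcal M_1}(a_2,b_2)\iff\{a_1,b_1\}=\{a_2,b_2\}$ whenever $a_1,b_1,a_2,b_2$ all lie in $\mathbb N$ or all in $\mathcal P(\mathbb N)$, arbitrary on mixed pairs. $\mathcal M_2$ is a $\tau$-model with $\mathcal M_1\prec\mathcal M_2$ (elementary extension) and $|P_1^{\mathcal M_2}|=|P_2^{\mathcal M_2}|=\lambda$ for some cardinal $\lambda\ge2^{\aleph_0}$. -}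

module Defs where

open import Level using (Level; Lift; lift; _⊔_) renaming (suc to lsuc; zero to lzero)
open import Data.Nat using (ℕ; _≤_)
open import Data.Bool using (Bool; true)
open import Data.Fin using (Fin; zero; suc)
open import Data.Sum using (_⊎_; inj₁; inj₂)
open import Data.Product using (Σ; ∃; _×_; _,_)
open import Data.Unit.Polymorphic using (⊤)
open import Data.Empty.Polymorphic using (⊥)
open import Relation.Nullary using (¬_)
open import Relation.Unary using (Pred)
open import Relation.Binary.PropositionalEquality using (_≡_; _≢_)
open import Function.Bundles using (_⇔_)

record Structure (c : Level) : Set (lsuc c) where
  field
    Carrier : Set c
    P₁ P₂   : Carrier → Set c
    R₁ R₂   : Carrier → Carrier → Set c
    F       : Carrier → Carrier → Carrier

open Structure public

Pᵢ : ∀ {c} (M : Structure c) → Fin 2 → Carrier M → Set c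
Pᵢ M zero    = P₁ M
Pᵢ M (suc _) = P₂ M

data Term (n : ℕ) : Set where
  var : Fin n → Term n
  app : Term n → Term n → Term n

data Formula : ℕ → Set where
  p₁ p₂      : ∀ {n} → Term n → Formula n
  r₁ r₂      : ∀ {n} → Term n → Term n → Formula n
  _≐_        : ∀ {n} → Term n → Term n → Formula n
  ff         : ∀ {n} → Formula n
  ∼_         : ∀ {n} → Formula n → Formula n
  _∧'_ _∨'_ _⇒'_ : ∀ {n} → Formula n → Formula n → Formula n
  ∀' ∃'      : ∀ {n} → Formula (ℕ.suc n) → Formula n

extend : ∀ {a} {A : Set a} {n} → (Fin n → A) → A → Fin (ℕ.suc n) → A
extend s x zero    = x
extend s x (suc i) = s i

evalT : ∀ {c} (M : Structure c) {n} → (Fin n → Carrier M) → Term n → Carrier M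
evalT M s (var i)   = s i
evalT M s (app t u) = F M (evalT M s t) (evalT M s u)

Sat : ∀ {c} (M : Structure c) {n} → Formula n → (Fin n → Carrier M) → Set c
Sat M (p₁ t)    s = P₁ M (evalT M s t)
Sat M (p₂ t)    s = P₂ M (evalT M s t)
Sat M (r₁ t u)  s = R₁ M (evalT M s t) (evalT M s u)
Sat M (r₂ t u)  s = R₂ M (evalT M s t) (evalT M s u)
Sat M (t ≐ u)   s = evalT M s t ≡ evalT M s u
Sat M ff        s = ⊥
Sat M (∼ φ)     s = ¬ Sat M φ s
Sat M (φ ∧' ψ)  s = Sat M φ s × Sat M ψ s
Sat M (φ ∨' ψ)  s = Sat M φ s ⊎ Sat M ψ s
Sat M (φ ⇒' ψ)  s = Sat M φ s → Sat M ψ s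
Sat M (∀' φ)    s = (x : Carrier M) → Sat M φ (extend s x)
Sat M (∃' φ)    s = Σ (Carrier M) (λ x → Sat M φ (extend s x))

IsElementary : ∀ {c d} (M : Structure c) (N : Structure d) →
               (Carrier M → Carrier N) → Set (c ⊔ d)
IsElementary M N e =
  ∀ {n} (φ : Formula n) (s : Fin n → Carrier M) → Sat M φ s ⇔ Sat N φ (λ i → e (s i))

record IsUltrafilter {c} {M : Set c} (D : Pred M c → Set c) : Set (lsuc c) where
  field
    upward : ∀ {A B : Pred M c} → D A → (∀ x → A x → B x) → D B
    inter  : ∀ {A B : Pred M c} → D A → D B → D (λ x → A x × B x)
    whole  : D (λ _ → ⊤)
    proper : ¬ D (λ _ → ⊥)
    ultra  : ∀ (A : Pred M c) → D A ⊎ D (λ x → ¬ A x)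

IsPrincipalAt : ∀ {c} {M : Set c} → (Pred M c → Set c) → M → Set (lsuc c)
IsPrincipalAt D a = ∀ A → D A ⇔ A a

Pβ : ∀ {c} (M : Structure c) → Fin 2 → (Pred (Carrier M) c → Set c) → Set c
Pβ M i D = D (Pᵢ M i)

Fβ : ∀ {c} (M : Structure c) → (D₁ D₂ : Pred (Carrier M) c → Set c) →
     Pred (Carrier M) c → Set c
Fβ M D₁ D₂ A = D₁ (λ x → D₂ (λ y → A (F M x y)))

_≋_ : ∀ {c} {M : Set c} → (Pred M c → Set c) → (Pred M c → Set c) → Set (lsuc c)
D ≋ E = ∀ A → D A ⇔ E A

Conclusion : ∀ {c} → Structure c → Set (lsuc c)
Conclusion {c} M =
  (i : Fin 2) (D₁ D₂ : Pred (Carrier M) c → Set c) →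
  IsUltrafilter D₁ → IsUltrafilter D₂ → Pβ M i D₁ →
  (a : Carrier M) → Pᵢ M i a → IsPrincipalAt D₂ a →
  Fβ M D₁ D₂ ≋ Fβ M D₂ D₁

-- The model 𝓜₁.  Universe ℕ ⊔ 𝒫(ℕ), with 𝒫(ℕ) rendered as ℕ → Bool
-- (characteristic functions).

𝒫ℕ : Set
𝒫ℕ = ℕ → Bool

C₁ : Set
C₁ = ℕ ⊎ 𝒫ℕ

P₁ᴹ : C₁ → Set
P₁ᴹ (inj₁ _) = ⊤
P₁ᴹ (inj₂ _) = ⊥

P₂ᴹ : C₁ → Set
P₂ᴹ (inj₁ _) = ⊥
P₂ᴹ (inj₂ _) = ⊤

R₁ᴹ : C₁ → C₁ → Set
R₁ᴹ (inj₁ n) (inj₂ a) = a n ≡ true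
R₁ᴹ _        _        = ⊥

mkM₁ : (R₂ : C₁ → C₁ → Set) (F : C₁ → C₁ → C₁) → Structure lzero
mkM₁ R₂ F = record { Carrier = C₁ ; P₁ = P₁ᴹ ; P₂ = P₂ᴹ ; R₁ = R₁ᴹ ; R₂ = R₂ ; F = F }

IsLinearNoEnds : {A : Set} → (A → A → Set) → Set
IsLinearNoEnds {A} _≺_ =
  (∀ a → a ≺ a) ×
  (∀ a b → a ≺ b → b ≺ a → a ≡ b) ×
  (∀ a b c → a ≺ b → b ≺ c → a ≺ c) ×
  (∀ a b → a ≺ b ⊎ b ≺ a) ×
  (∀ a → ∃ λ b → b ≺ a × b ≢ a) ×
  (∀ a → ∃ λ b → a ≺ b × a ≢ b)

PairCode : {A B : Set} → (A → B) → (B → B → B) → Set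
PairCode ι F = ∀ a₁ b₁ a₂ b₂ →
  F (ι a₁) (ι b₁) ≡ F (ι a₂) (ι b₂) ⇔ ((a₁ ≡ a₂ × b₁ ≡ b₂) ⊎ (a₁ ≡ b₂ × b₁ ≡ a₂))

IsM₁ : (R₂ : C₁ → C₁ → Set) (F : C₁ → C₁ → C₁) → Set
IsM₁ R₂ F =
  (∀ m n → R₂ (inj₁ m) (inj₁ n) ⇔ m ≤ n) ×
  IsLinearNoEnds (λ a b → R₂ (inj₂ a) (inj₂ b)) ×
  (∀ m n → ∃ λ k → F (inj₁ m) (inj₁ n) ≡ inj₁ k) ×
  (∀ a b → ∃ λ c → F (inj₂ a) (inj₂ b) ≡ inj₂ c) ×
  PairCode inj₁ F ×
  PairCode inj₂ F

SameCard : ∀ {c} {M : Set c} → (M → Set c) → (M → Set c) → Set c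
SameCard {M = M} P Q = Σ (M → M) λ h →
  (∀ x → P x → Q (h x)) ×
  (∀ x y → P x → P y → h x ≡ h y → x ≡ y) ×
  (∀ y → Q y → Σ M λ x → P x × h x ≡ y)

ContinuumLe : ∀ {c} {M : Set c} → (M → Set c) → Set c
ContinuumLe {M = M} P = Σ (𝒫ℕ → M) λ f →
  (∀ a → P (f a)) × (∀ a b → f a ≡ f b → a ≡ b)

-- Since D₂ is principal at a, F^β(D₁,D₂) and F^β(D₂,D₁) are the images of D₁
-- under x ↦ F(x,a) and x ↦ F(a,x).  These maps agree on P_i, which belongs to
-- D₁, so the images coincide.  Commutativity of F on P_i holds in 𝓜₁ because
-- F codes unordered pairs there, and it passes to 𝓜₂ as a first-order sentence.
module Submission where

open import Defs
open import Level using (Level; lift)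
open import Data.Product using (_×_; _,_)
open import Data.Sum using (inj₁; inj₂)
open import Data.Fin using (Fin; zero; suc)
open import Relation.Unary using (Pred)
open import Function.Bundles using (_⇔_; mk⇔; Equivalence)
open import Relation.Binary.PropositionalEquality using (_≡_; refl; subst; sym)

open Equivalence

CommutesOn : ∀ {c} {A : Set c} → (A → Set c) → (A → A → A) → Set c
CommutesOn P _∙_ = ∀ x y → P x → P y → x ∙ y ≡ y ∙ x

module _ {c} (M : Structure c) {P : Carrier M → Set c} (comm : CommutesOn P (F M))
         {D₁ D₂ : Pred (Carrier M) c → Set c} (U₁ : IsUltrafilter D₁) (P∈D₁ : D₁ P)
         {a : Carrier M} (Pa : P a) (D₂≡j[a] : IsPrincipalAt D₂ a) where

  open IsUltrafilter U₁

  Fβ-principalʳ : ∀ A → Fβ M D₁ D₂ A ⇔ D₁ (λ x → A (F M x a))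
  Fβ-principalʳ A = mk⇔ (λ h → upward h λ x → to (D₂≡j[a] _))
                        (λ h → upward h λ x → from (D₂≡j[a] _))

  Fβ-principalˡ : ∀ A → Fβ M D₂ D₁ A ⇔ D₁ (λ x → A (F M a x))
  Fβ-principalˡ A = D₂≡j[a] _

  image-swap : ∀ A → D₁ (λ x → A (F M x a)) → D₁ (λ x → A (F M a x))
  image-swap A h = upward (inter P∈D₁ h) λ x (Px , q) → subst A (comm x a Px Pa) q

  image-swap⁻ : ∀ A → D₁ (λ x → A (F M a x)) → D₁ (λ x → A (F M x a))
  image-swap⁻ A h = upward (inter P∈D₁ h) λ x (Px , q) → subst A (sym (comm x a Px Pa)) q

  Fβ-comm-principal : Fβ M D₁ D₂ ≋ Fβ M D₂ D₁
  Fβ-comm-principal A = mk⇔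
    (λ h → from (Fβ-principalˡ A) (image-swap A (to (Fβ-principalʳ A) h)))
    (λ h → from (Fβ-principalʳ A) (image-swap⁻ A (to (Fβ-principalˡ A) h)))

conclusion-of-commutesOn : ∀ {c} (M : Structure c) →
  (∀ i → CommutesOn (Pᵢ M i) (F M)) → Conclusion M
conclusion-of-commutesOn M comm i D₁ D₂ U₁ _ P∈D₁ a Pa D₂≡j[a] =
  Fβ-comm-principal M (comm i) U₁ P∈D₁ Pa D₂≡j[a]

PairCode⇒comm : {A B : Set} (ι : A → B) (_∙_ : B → B → B) →
  PairCode ι _∙_ → ∀ a b → ι a ∙ ι b ≡ ι b ∙ ι a
PairCode⇒comm _ _ code a b = from (code a b b a) (inj₂ (refl , refl))

M₁-commutesOn : ∀ {R₂ F₀} → IsM₁ R₂ F₀ → ∀ i → CommutesOn (Pᵢ (mkM₁ R₂ F₀) i) F₀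
M₁-commutesOn {F₀ = F₀} (_ , _ , _ , _ , code₁ , _) zero (inj₁ m) (inj₁ n) _ _ =
  PairCode⇒comm inj₁ F₀ code₁ m n
M₁-commutesOn {F₀ = F₀} (_ , _ , _ , _ , _ , code₂) (suc _) (inj₂ a) (inj₂ b) _ _ =
  PairCode⇒comm inj₂ F₀ code₂ a b
M₁-commutesOn _ zero    (inj₂ _) _        (lift ()) _
M₁-commutesOn _ zero    (inj₁ _) (inj₂ _) _         (lift ())
M₁-commutesOn _ (suc _) (inj₁ _) _        (lift ()) _
M₁-commutesOn _ (suc _) (inj₂ _) (inj₁ _) _         (lift ())

pᵢ : ∀ {n} → Fin 2 → Term n → Formula n
pᵢ zero    = p₁
pᵢ (suc _) = p₂

commutesOnᵢ : Fin 2 → Formula 0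
commutesOnᵢ i = ∀' (∀' ((pᵢ i x ∧' pᵢ i y) ⇒' (app x y ≐ app y x)))
  where
  x y : Term 2
  x = var (suc zero)
  y = var zero

Sat-commutesOnᵢ : ∀ {c} (M : Structure c) i (s : Fin 0 → Carrier M) →
  Sat M (commutesOnᵢ i) s ⇔ CommutesOn (Pᵢ M i) (F M)
Sat-commutesOnᵢ M zero    s = mk⇔ (λ h x y p q → h x y (p , q)) (λ h x y (p , q) → h x y p q)
Sat-commutesOnᵢ M (suc _) s = mk⇔ (λ h x y p q → h x y (p , q)) (λ h x y (p , q) → h x y p q)

elementary-commutesOn : ∀ {c d} {M : Structure c} {N : Structure d} {e : Carrier M → Carrier N} →
  IsElementary M N e → ∀ i → CommutesOn (Pᵢ M i) (F M) → CommutesOn (Pᵢ N i) (F N)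
elementary-commutesOn {M = M} {N} {e} elem i comm =
  to (Sat-commutesOnᵢ N i (λ k → e (s₀ k)))
     (to (elem (commutesOnᵢ i) s₀) (from (Sat-commutesOnᵢ M i s₀) comm))
  where
  s₀ : Fin 0 → Carrier M
  s₀ ()

lemma2 : {c : Level}
    (R₂ : C₁ → C₁ → Set) (F : C₁ → C₁ → C₁) → IsM₁ R₂ F →
    (M₂ : Structure c) (e : C₁ → Carrier M₂) → IsElementary (mkM₁ R₂ F) M₂ e →
    SameCard (P₁ M₂) (P₂ M₂) → ContinuumLe (P₁ M₂) →
    Conclusion (mkM₁ R₂ F) × Conclusion M₂
lemma2 R₂ F isM₁ M₂ e elem _ _ =
  conclusion-of-commutesOn (mkM₁ R₂ F) (M₁-commutesOn isM₁) ,
  conclusion-of-commutesOn M₂ (λ i → elementary-commutesOn {e = e} elem i (M₁-commutesOn isM₁ i))
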